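{- Let $G$ and $H$ be hypergraphs with $G\cong_f H$, and let $B_G$ and $B_H$ be their bipartite (incidence) graphs. Then $B_G\cong_f B_H$ as graphs.
   Context: A hypergraph $G=(V,X)$ consists of a finite vertex set $V$ and a family $X$ of subsets of $V$ (hyperedges). If $G$ has $n$ vertices and $m\ge1$ hyperedges, its vertex-hyperedge incidence matrix $M_G\in\{0,1\}^{n\times m}$ has $(i,j)$ entry $1$ iff vertex $i$ belongs to hyperedge $j$. A doubly stochastic matrix is a square nonnegative matrix whose rows and columns each sum to $1$. For hypergraphs, $G\cong_f H$ means: either $G$ and $H$ have the same number of vertices and no hyperedges, or there exist doubly stochastic matrices $S_1,S_2$ with $S_1M_G=M_HS_2^t$ and $M_GS_2=S_1^tM_H$. The bipartite graph $B_G$ has one vertex for each vertex of $G$ and one for each hyperedge of $G$, with a vertex-node adjacent to a hyperedge-node iff the vertex belongs to the hyperedge; its adjacency matrix is $\begin{bmatrix}0&M_G\\ M_G^t&0\end{bmatrix}$. For graphs with adjacency matrices $A,B$, $\cong_f$ means there is a doubly stochastic $S$ with $AS=SB$.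
   Formalization: The doubly stochastic matrices $S_1,S_2$ and $S$ in both notions of $\cong_f$ have rational entries. -}

module Defs where

open import Data.Nat using (ℕ; zero; suc; _+_)
open import Data.Fin using (Fin; zero; suc; splitAt)
open import Data.Fin.Subset using (Subset; _∈_)
open import Data.Fin.Subset.Properties using (_∈?_)
open import Data.Rational using (ℚ; 0ℚ; 1ℚ; _≤_) renaming (_+_ to _+ℚ_; _*_ to _*ℚ_)
open import Data.Sum using (_⊎_; inj₁; inj₂)
open import Data.Product using (Σ; _×_)
open import Relation.Binary.PropositionalEquality using (_≡_; subst₂; sym)
open import Relation.Nullary using (does)
open import Data.Bool using (if_then_else_)

Mat : ℕ → ℕ → Set
Mat a b = Fin a → Fin b → ℚ

∑ : (k : ℕ) → (Fin k → ℚ) → ℚ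
∑ zero    f = 0ℚ
∑ (suc k) f = f zero +ℚ ∑ k (λ i → f (suc i))

_·_ : ∀ {a b c} → Mat a b → Mat b c → Mat a c
_·_ {b = b} A B i j = ∑ b (λ k → A i k *ℚ B k j)

_ᵗ : ∀ {a b} → Mat a b → Mat b a
(A ᵗ) i j = A j i

_≈M_ : ∀ {a b} → Mat a b → Mat a b → Set
A ≈M B = ∀ i j → A i j ≡ B i j

DoublyStochastic : ∀ {k} → Mat k k → Set
DoublyStochastic {k} S =
  (∀ i j → 0ℚ ≤ S i j) ×
  (∀ i → ∑ k (λ j → S i j) ≡ 1ℚ) ×
  (∀ j → ∑ k (λ i → S i j) ≡ 1ℚ)

Hypergraph : ℕ → ℕ → Set
Hypergraph n m = Fin m → Subset n

incidence : ∀ {n m} → Hypergraph n m → Mat n m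
incidence G i j = if does (i ∈? G j) then 1ℚ else 0ℚ

FracIsoSame : ∀ {n m} → Hypergraph n m → Hypergraph n m → Set
FracIsoSame {n} {m} G H =
  Σ (Mat n n) λ S₁ → Σ (Mat m m) λ S₂ →
    DoublyStochastic S₁ × DoublyStochastic S₂ ×
    ((S₁ · incidence G) ≈M (incidence H · (S₂ ᵗ))) ×
    ((incidence G · S₂) ≈M ((S₁ ᵗ) · incidence H))

_≅h_ : ∀ {n m n' m'} → Hypergraph n m → Hypergraph n' m' → Set
_≅h_ {n} {m} {n'} {m'} G H =
  (n ≡ n' × m ≡ 0 × m' ≡ 0) ⊎
  Σ (n ≡ n') λ p → Σ (m ≡ m') λ q →
    FracIsoSame G (subst₂ Hypergraph (sym p) (sym q) H)

_≅g_ : ∀ {N N'} → Mat N N → Mat N' N' → Set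
_≅g_ {N} {N'} A B =
  Σ (N ≡ N') λ p →
    Σ (Mat N N) λ S → DoublyStochastic S ×
      ((A · S) ≈M (S · subst₂ Mat (sym p) (sym p) B))

-- adjacency matrix of the bipartite incidence graph B_G:
-- vertices Fin n then hyperedges Fin m, block matrix [[0, M],[Mᵗ, 0]]
bipartite : ∀ {n m} → Hypergraph n m → Mat (n + m) (n + m)
bipartite {n} G x y with splitAt n x | splitAt n y
... | inj₁ i | inj₂ j = incidence G i j
... | inj₂ j | inj₁ i = incidence G i j
... | inj₁ _ | inj₁ _ = 0ℚ
... | inj₂ _ | inj₂ _ = 0ℚ

{-# OPTIONS --safe #-}
module Submission where

-- For a fractional isomorphism (S₁, S₂) the block-diagonal matrix S₁ᵗ ⊕ S₂ is doubly stochastic, and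
-- multiplying out the blocks, B_G (S₁ᵗ ⊕ S₂) = (S₁ᵗ ⊕ S₂) B_H says exactly M_G S₂ = S₁ᵗ M_H and
-- M_Gᵗ S₁ᵗ = S₂ M_Hᵗ, i.e. the second hypothesis and the transpose of the first.
-- Edgeless hypergraphs on the same vertex set are fractionally isomorphic via the identity matrix.

open import Defs
open import Data.Nat using (ℕ; zero; suc; _+_)
open import Data.Fin using (Fin; zero; suc; splitAt; _↑ˡ_; _↑ʳ_)
open import Data.Fin.Properties using (splitAt-↑ˡ; splitAt-↑ʳ)
open import Data.Rational using (ℚ; 0ℚ; 1ℚ; _≤_) renaming (_+_ to _+ℚ_; _*_ to _*ℚ_)
open import Data.Rational.Properties
  using (+-identityˡ; +-identityʳ; +-assoc; *-zeroˡ; *-zeroʳ; *-comm; ≤-refl; nonNegative⁻¹)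
open import Data.Sum using (inj₁; inj₂; [_,_]′)
open import Data.Product using (_,_)
open import Relation.Binary.Bundles using (Setoid)
open import Relation.Binary.PropositionalEquality
import Relation.Binary.Reasoning.Setoid as SetoidReasoning

private
  variable
    a b c d e f k : ℕ

∑-cong : ∀ k {u v : Fin k → ℚ} → (∀ i → u i ≡ v i) → ∑ k u ≡ ∑ k v
∑-cong zero    u≡v = refl
∑-cong (suc k) u≡v = cong₂ _+ℚ_ (u≡v zero) (∑-cong k (λ i → u≡v (suc i)))

∑-zero : ∀ k → ∑ k (λ _ → 0ℚ) ≡ 0ℚ
∑-zero zero    = refl
∑-zero (suc k) = trans (cong (0ℚ +ℚ_) (∑-zero k)) (+-identityʳ 0ℚ)

∑-↑ : ∀ c d (u : Fin (c + d) → ℚ) →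
      ∑ (c + d) u ≡ ∑ c (λ i → u (i ↑ˡ d)) +ℚ ∑ d (λ j → u (c ↑ʳ j))
∑-↑ zero    d u = sym (+-identityˡ _)
∑-↑ (suc c) d u = trans (cong (u zero +ℚ_) (∑-↑ c d (λ i → u (suc i)))) (sym (+-assoc (u zero) _ _))

∑-[,]-splitAt : ∀ c d (u : Fin c → ℚ) (v : Fin d → ℚ) →
                ∑ (c + d) (λ k → [ u , v ]′ (splitAt c k)) ≡ ∑ c u +ℚ ∑ d v
∑-[,]-splitAt c d u v = trans (∑-↑ c d _)
  (cong₂ _+ℚ_ (∑-cong c (λ i → cong [ u , v ]′ (splitAt-↑ˡ c i d)))
              (∑-cong d (λ j → cong [ u , v ]′ (splitAt-↑ʳ c d j))))

∑-[,]-splitAt-* : ∀ c d {u u' : Fin c → ℚ} {v v' : Fin d → ℚ} →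
  ∑ (c + d) (λ k → [ u , v ]′ (splitAt c k) *ℚ [ u' , v' ]′ (splitAt c k))
    ≡ ∑ c (λ k → u k *ℚ u' k) +ℚ ∑ d (λ k → v k *ℚ v' k)
∑-[,]-splitAt-* c d {u} {u'} {v} {v'} = trans (∑-cong (c + d) (λ k → [,]-* (splitAt c k)))
                                             (∑-[,]-splitAt c d _ _)
  where
  [,]-* : ∀ s → [ u , v ]′ s *ℚ [ u' , v' ]′ s ≡ [ (λ k → u k *ℚ u' k) , (λ k → v k *ℚ v' k) ]′ s
  [,]-* (inj₁ _) = refl
  [,]-* (inj₂ _) = refl

≈M-setoid : ℕ → ℕ → Setoid _ _
≈M-setoid a b = record
  { Carrier       = Mat a b
  ; _≈_           = _≈M_
  ; isEquivalence = record
    { refl  = λ _ _ → refl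
    ; sym   = λ A≈B i j → sym (A≈B i j)
    ; trans = λ A≈B B≈C i j → trans (A≈B i j) (B≈C i j)
    }
  }

module ≈M {a b : ℕ} = Setoid (≈M-setoid a b)
module ≈M-Reasoning {a b : ℕ} = SetoidReasoning (≈M-setoid a b)

0M : Mat a b
0M _ _ = 0ℚ

infixl 6 _+M_
_+M_ : Mat a b → Mat a b → Mat a b
(A +M B) i j = A i j +ℚ B i j

·-cong : {A A' : Mat a b} {B B' : Mat b c} → A ≈M A' → B ≈M B' → (A · B) ≈M (A' · B')
·-cong {b = b} A≈A' B≈B' i j = ∑-cong b (λ k → cong₂ _*ℚ_ (A≈A' i k) (B≈B' k j))

·-zeroˡ : (B : Mat b c) → (0M {a} · B) ≈M 0M
·-zeroˡ {b} B i j = trans (∑-cong b (λ k → *-zeroˡ (B k j))) (∑-zero b)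

·-zeroʳ : (A : Mat a b) → (A · 0M {b} {c}) ≈M 0M
·-zeroʳ {b = b} A i j = trans (∑-cong b (λ k → *-zeroʳ (A i k))) (∑-zero b)

·-ᵗ : (A : Mat a b) (B : Mat b c) → ((A · B) ᵗ) ≈M ((B ᵗ) · (A ᵗ))
·-ᵗ {b = b} A B i j = ∑-cong b (λ k → *-comm (A j k) (B k i))

+M-zero : {A B : Mat a b} → A ≈M 0M → B ≈M 0M → (A +M B) ≈M 0M
+M-zero A≈0 B≈0 i j = trans (cong₂ _+ℚ_ (A≈0 i j) (B≈0 i j)) (+-identityʳ 0ℚ)

+M-identityˡ : {A B : Mat a b} → A ≈M 0M → (A +M B) ≈M B
+M-identityˡ {B = B} A≈0 i j = trans (cong (_+ℚ B i j) (A≈0 i j)) (+-identityˡ (B i j))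

+M-identityʳ : {A B : Mat a b} → B ≈M 0M → (A +M B) ≈M A
+M-identityʳ {A = A} B≈0 i j = trans (cong (A i j +ℚ_) (B≈0 i j)) (+-identityʳ (A i j))

ᵗ-doublyStochastic : {S : Mat k k} → DoublyStochastic S → DoublyStochastic (S ᵗ)
ᵗ-doublyStochastic (S≥0 , rows , cols) = (λ i j → S≥0 j i) , cols , rows

-- Written with [_,_]′ rather than with, so that with-abstracting splitAt inside a proof also reduces block.
block : Mat a c → Mat a d → Mat b c → Mat b d → Mat (a + b) (c + d)
block {a} {c} A B C D x y =
  [ (λ i → [ A i , B i ]′ (splitAt c y)) , (λ i → [ C i , D i ]′ (splitAt c y)) ]′ (splitAt a x)

block-cong : {A A' : Mat a c} {B B' : Mat a d} {C C' : Mat b c} {D D' : Mat b d} →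
             A ≈M A' → B ≈M B' → C ≈M C' → D ≈M D' → block A B C D ≈M block A' B' C' D'
block-cong {a} {c} A≈ B≈ C≈ D≈ x y with splitAt a x | splitAt c y
... | inj₁ i | inj₁ j = A≈ i j
... | inj₁ i | inj₂ j = B≈ i j
... | inj₂ i | inj₁ j = C≈ i j
... | inj₂ i | inj₂ j = D≈ i j

block-· : (A : Mat a c) (B : Mat a d) (C : Mat b c) (D : Mat b d)
          (A' : Mat c e) (B' : Mat c f) (C' : Mat d e) (D' : Mat d f) →
          (block A B C D · block A' B' C' D')
            ≈M block ((A · A') +M (B · C')) ((A · B') +M (B · D'))
                     ((C · A') +M (D · C')) ((C · B') +M (D · D'))
block-· {a} {c} {d} {e = e} _ _ _ _ _ _ _ _ x y with splitAt a x | splitAt e y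
... | inj₁ _ | inj₁ _ = ∑-[,]-splitAt-* c d
... | inj₁ _ | inj₂ _ = ∑-[,]-splitAt-* c d
... | inj₂ _ | inj₁ _ = ∑-[,]-splitAt-* c d
... | inj₂ _ | inj₂ _ = ∑-[,]-splitAt-* c d

antidiagonal : Mat a d → Mat b c → Mat (a + b) (c + d)
antidiagonal B C = block 0M B C 0M

infixl 6 _⊕_
_⊕_ : Mat a c → Mat b d → Mat (a + b) (c + d)
A ⊕ D = block A 0M 0M D

antidiagonal-·-⊕ : (B : Mat a d) (C : Mat b c) (D : Mat c c) (E : Mat d d) →
                   (antidiagonal B C · (D ⊕ E)) ≈M antidiagonal (B · E) (C · D)
antidiagonal-·-⊕ {d = d} {c = c} B C D E = ≈M.trans (block-· 0M B C 0M D 0M 0M E)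
  (block-cong (+M-zero (·-zeroˡ D) (·-zeroʳ B)) (+M-identityˡ (·-zeroˡ (0M {c} {d})))
              (+M-identityʳ (·-zeroˡ (0M {d} {c})))      (+M-zero (·-zeroʳ C) (·-zeroˡ E)))

⊕-·-antidiagonal : (D : Mat a a) (E : Mat b b) (B : Mat a d) (C : Mat b c) →
                   ((D ⊕ E) · antidiagonal B C) ≈M antidiagonal (D · B) (E · C)
⊕-·-antidiagonal {a = a} {b = b} {d = d} {c = c} D E B C = ≈M.trans (block-· D 0M 0M E 0M B C 0M)
  (block-cong (+M-zero (·-zeroʳ D) (·-zeroˡ C)) (+M-identityʳ (·-zeroˡ (0M {b} {d})))
              (+M-identityˡ (·-zeroˡ (0M {a} {c})))      (+M-zero (·-zeroˡ B) (·-zeroʳ E)))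

⊕-doublyStochastic : {D : Mat a a} {E : Mat b b} →
                     DoublyStochastic D → DoublyStochastic E → DoublyStochastic (D ⊕ E)
⊕-doublyStochastic {a} {b} {D} {E} (D≥0 , D-rows , D-cols) (E≥0 , E-rows , E-cols) =
  nonNegative , rows , cols
  where
  nonNegative : ∀ x y → 0ℚ ≤ (D ⊕ E) x y
  nonNegative x y with splitAt a x | splitAt a y
  ... | inj₁ i | inj₁ j = D≥0 i j
  ... | inj₁ _ | inj₂ _ = ≤-refl
  ... | inj₂ _ | inj₁ _ = ≤-refl
  ... | inj₂ i | inj₂ j = E≥0 i j

  ∑-halves≡1 : ∀ {p q} {u : Fin a → ℚ} {v : Fin b → ℚ} →
                  ∑ a u ≡ p → ∑ b v ≡ q → p +ℚ q ≡ 1ℚ → ∑ (a + b) (λ k → [ u , v ]′ (splitAt a k)) ≡ 1ℚ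
  ∑-halves≡1 ∑u ∑v p+q≡1 = trans (∑-[,]-splitAt a b _ _) (trans (cong₂ _+ℚ_ ∑u ∑v) p+q≡1)

  rows : ∀ x → ∑ (a + b) ((D ⊕ E) x) ≡ 1ℚ
  rows x with splitAt a x
  ... | inj₁ i = ∑-halves≡1 (D-rows i) (∑-zero b) (+-identityʳ 1ℚ)
  ... | inj₂ i = ∑-halves≡1 (∑-zero a) (E-rows i) (+-identityˡ 1ℚ)

  cols : ∀ y → ∑ (a + b) (λ x → (D ⊕ E) x y) ≡ 1ℚ
  cols y with splitAt a y
  ... | inj₁ j = ∑-halves≡1 (D-cols j) (∑-zero b) (+-identityʳ 1ℚ)
  ... | inj₂ j = ∑-halves≡1 (∑-zero a) (E-cols j) (+-identityˡ 1ℚ)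

bipartite≈antidiagonal : (G : Hypergraph a b) → bipartite G ≈M antidiagonal (incidence G) (incidence G ᵗ)
bipartite≈antidiagonal {a} G x y with splitAt a x | splitAt a y
... | inj₁ _ | inj₁ _ = refl
... | inj₁ _ | inj₂ _ = refl
... | inj₂ _ | inj₁ _ = refl
... | inj₂ _ | inj₂ _ = refl

1M : Mat k k
1M zero    zero    = 1ℚ
1M zero    (suc _) = 0ℚ
1M (suc _) zero    = 0ℚ
1M (suc i) (suc j) = 1M i j

1M-doublyStochastic : DoublyStochastic (1M {k})
1M-doublyStochastic {k} = nonNegative , rows k , cols k
  where
  nonNegative : ∀ {k} (i j : Fin k) → 0ℚ ≤ 1M i j
  nonNegative zero    zero    = nonNegative⁻¹ 1ℚ
  nonNegative zero    (suc _) = ≤-refl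
  nonNegative (suc _) zero    = ≤-refl
  nonNegative (suc i) (suc j) = nonNegative i j

  rows : ∀ k (i : Fin k) → ∑ k (1M i) ≡ 1ℚ
  rows (suc k) zero    = trans (cong (1ℚ +ℚ_) (∑-zero k)) (+-identityʳ 1ℚ)
  rows (suc k) (suc i) = trans (+-identityˡ _) (rows k i)

  cols : ∀ k (j : Fin k) → ∑ k (λ i → 1M i j) ≡ 1ℚ
  cols (suc k) zero    = trans (cong (1ℚ +ℚ_) (∑-zero k)) (+-identityʳ 1ℚ)
  cols (suc k) (suc j) = trans (+-identityˡ _) (cols k j)

edgeless-fracIso : (G H : Hypergraph a 0) → FracIsoSame G H
edgeless-fracIso G H = 1M , (λ ()) , 1M-doublyStochastic , ((λ ()) , (λ ()) , (λ ())) , (λ _ ()) , (λ _ ())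

fracIso⇒bipartite-fracIso : (G H : Hypergraph a b) → FracIsoSame G H → bipartite G ≅g bipartite H
fracIso⇒bipartite-fracIso G H (S₁ , S₂ , S₁-ds , S₂-ds , S₁MG≈MHS₂ᵗ , MGS₂≈S₁ᵗMH) =
  refl , S , ⊕-doublyStochastic (ᵗ-doublyStochastic S₁-ds) S₂-ds , intertwines
  where
  open ≈M-Reasoning
  MG = incidence G
  MH = incidence H
  S  = (S₁ ᵗ) ⊕ S₂

  MGᵗS₁ᵗ≈S₂MHᵗ : ((MG ᵗ) · (S₁ ᵗ)) ≈M (S₂ · (MH ᵗ))
  MGᵗS₁ᵗ≈S₂MHᵗ i j = trans (sym (·-ᵗ S₁ MG i j)) (trans (S₁MG≈MHS₂ᵗ j i) (·-ᵗ MH (S₂ ᵗ) i j))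

  intertwines : (bipartite G · S) ≈M (S · bipartite H)
  intertwines = begin
    bipartite G · S                           ≈⟨ ·-cong (bipartite≈antidiagonal G) (≈M.refl {x = S}) ⟩
    antidiagonal MG (MG ᵗ) · S                ≈⟨ antidiagonal-·-⊕ MG (MG ᵗ) (S₁ ᵗ) S₂ ⟩
    antidiagonal (MG · S₂) ((MG ᵗ) · (S₁ ᵗ))  ≈⟨ block-cong ≈M.refl MGS₂≈S₁ᵗMH MGᵗS₁ᵗ≈S₂MHᵗ ≈M.refl ⟩
    antidiagonal ((S₁ ᵗ) · MH) (S₂ · (MH ᵗ))  ≈⟨ ⊕-·-antidiagonal (S₁ ᵗ) S₂ MH (MH ᵗ) ⟨
    S · antidiagonal MH (MH ᵗ)                ≈⟨ ·-cong (≈M.refl {x = S}) (bipartite≈antidiagonal H) ⟨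
    S · bipartite H                           ∎

mainTheorem11 : ∀ {n m n' m'} (G : Hypergraph n m) (H : Hypergraph n' m') →
    G ≅h H → bipartite G ≅g bipartite H
mainTheorem11 G H (inj₁ (refl , refl , refl))  = fracIso⇒bipartite-fracIso G H (edgeless-fracIso G H)
mainTheorem11 G H (inj₂ (refl , refl , G≅H)) = fracIso⇒bipartite-fracIso G H G≅H
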